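{- For all $\tau\in(0,1/2)$ and $\varepsilon>0$ there is $\nu_0\in(0,\tau]$ such that for every $\nu\in(0,\nu_0]$ there is $n_0$ such that for all $n\ge n_0$ the following holds. Let $G$ be a balanced tripartite digraph on $3n$ vertices which is $d$-regular for some $d\ge(1+\varepsilon)n$. Then $G$ is a robust $(\nu,\tau)$-outexpander.
   Context: A balanced tripartite digraph on $3n$ vertices has its vertex set partitioned into three independent sets of size $n$; it is $d$-regular if every vertex has in- and outdegree $d$. For an $N$-vertex digraph $G$, $S\subseteq V(G)$ and $\nu\in[0,1]$, $RN^+_{\nu,G}(S)=\{v\in V(G): v \text{ has at least } \nu N \text{ inneighbours in } S\}$. For $0<\nu\le\tau<1/2$, $G$ is a robust $(\nu,\tau)$-outexpander if $|RN^+_{\nu,G}(S)|\ge|S|+\nu N$ for all $S\subseteq V(G)$ with $\tau N\le|S|\le(1-\tau)N$. -}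

module Defs where

open import Data.Nat using (ℕ; _*_)
open import Data.Bool using (Bool; true; false; if_then_else_)
open import Data.Fin using (Fin)
open import Data.Fin.Subset using (Subset; _∈_; _∩_; ∣_∣; inside; outside)
open import Data.Vec using (tabulate)
open import Data.Product using (_×_)
open import Data.Integer using () renaming (+_ to ℤ+_)
open import Data.Rational using (ℚ; _/_; _≤_; _≤?_; _+_; _-_; 1ℚ) renaming (_*_ to _*ℚ_)
open import Relation.Binary.PropositionalEquality using (_≡_)
open import Relation.Nullary using (does)
open import Data.Fin using (_≟_)

Digraph : ℕ → Set
Digraph N = Fin N → Fin N → Bool

ℕ→ℚ : ℕ → ℚ
ℕ→ℚ k = ℤ+ k / 1

boolSide : Bool → Data.Fin.Subset.Side
boolSide true = inside
boolSide false = outside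

outNbhd : ∀ {N} → Digraph N → Fin N → Subset N
outNbhd E v = tabulate (λ u → boolSide (E v u))

inNbhd : ∀ {N} → Digraph N → Fin N → Subset N
inNbhd E v = tabulate (λ u → boolSide (E u v))

Regular : ∀ {N} → Digraph N → ℕ → Set
Regular {N} E d = (v : Fin N) → (∣ outNbhd E v ∣ ≡ d) × (∣ inNbhd E v ∣ ≡ d)

record BalancedTripartite (n : ℕ) (E : Digraph (3 * n)) : Set where
  field
    part        : Fin (3 * n) → Fin 3
    partSize    : (i : Fin 3) → ∣ tabulate (λ v → boolSide (does (part v ≟ i))) ∣ ≡ n
    independent : (u v : Fin (3 * n)) → part u ≡ part v → E u v ≡ false

RN⁺ : ∀ {N} → ℚ → Digraph N → Subset N → Subset N
RN⁺ {N} ν E S = tabulate (λ v → boolSide (does (ν *ℚ ℕ→ℚ N ≤? (ℕ→ℚ ∣ S ∩ inNbhd E v ∣))))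

RobustOutexpander : ∀ {N} → ℚ → ℚ → Digraph N → Set
RobustOutexpander {N} ν τ E =
  (S : Subset N) → τ *ℚ ℕ→ℚ N ≤ (ℕ→ℚ ∣ S ∣) → (ℕ→ℚ ∣ S ∣) ≤ (1ℚ - τ) *ℚ ℕ→ℚ N →
  (ℕ→ℚ ∣ S ∣) + ν *ℚ ℕ→ℚ N ≤ (ℕ→ℚ ∣ RN⁺ ν E S ∣)

{-# OPTIONS --safe #-}
module Submission where

-- Let ε ≥ 1/L and τ ≥ 1/M, write d = n + D (so n ≤ LD) and take ν₀ = 1/K with K of order L²M.  Every
-- vertex outside T = RN⁺(S) has fewer than νN ≤ 3n/K inneighbours in S.  For each part V_j count
-- s_j = |S ∩ V_j|, σ_j = |S ∖ V_j|, t_j = |T ∩ V_j| and the number e_j of edges from S into V_j, so that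
-- Σ e_j = d|S|.  As the parts are independent, each vertex of S ∖ V_j sends at least D edges into V_j,
-- the inneighbours of a vertex of V_j lie outside V_j, and a vertex of V_j ∖ T forces σ_j + D ≤ n + 3n/K.
-- If T ⊇ V(G), then |S| ≤ (1 - τ)N suffices.  If T misses vertices of exactly one part p, then
-- |S| ≤ n + σ_p ≤ 2n - D + 3n/K.  If T misses vertices of two parts p and q, either t_p + t_q ≥ n/2L and
-- d|S| = Σ e_j ≤ σ_p t_p + σ_q t_q + d t_r + 9n²/K gives |T| ≥ |S| + 3n/K, or t_p + t_q < n/2L, whence
-- σ_p, σ_q ≤ 6Ln/K, contradicting τN ≤ |S| ≤ σ_p + σ_q.

module Sums where

  open import Data.Bool using (Bool; true; false; _∧_; not)
  open import Data.Nat using (ℕ; zero; suc; _+_; _*_; _≤_; _<_; _<?_; z≤n; s≤s)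
  open import Data.Nat.Properties hiding (_≟_)
  open import Data.Fin using (Fin; zero; suc; _≟_)
  open import Data.Fin.Patterns using (0F; 1F; 2F)
  open import Data.Fin.Subset using (Subset; ∣_∣; _∩_)
  open import Data.Vec using ([]; _∷_; lookup; tabulate)
  open import Data.Vec.Properties using (lookup∘tabulate; lookup-zipWith)
  open import Data.Product using (∃; _,_)
  open import Function using (_∘_)
  open import Relation.Binary.PropositionalEquality
  open import Relation.Nullary using (does; yes; no)
  open import Algebra.Properties.Semiring.Sum +-*-semiring public
  open import Defs using (boolSide)

  ⟦_⟧ : Bool → ℕ
  ⟦ true ⟧  = 1
  ⟦ false ⟧ = 0

  infixr 7 _·_

  _·_ : Bool → ℕ → ℕ
  true  · x = x
  false · x = 0

  ⟦⟧≤1 : ∀ b → ⟦ b ⟧ ≤ 1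
  ⟦⟧≤1 true  = s≤s z≤n
  ⟦⟧≤1 false = z≤n

  ⟦⟧+⟦not⟧ : ∀ b → ⟦ b ⟧ + ⟦ not b ⟧ ≡ 1
  ⟦⟧+⟦not⟧ true  = refl
  ⟦⟧+⟦not⟧ false = refl

  ·≤ : ∀ b x → b · x ≤ x
  ·≤ true  x = ≤-refl
  ·≤ false x = z≤n

  ·⟦⟧≤⟦⟧ : ∀ b c → b · ⟦ c ⟧ ≤ ⟦ b ⟧
  ·⟦⟧≤⟦⟧ true  c = ⟦⟧≤1 c
  ·⟦⟧≤⟦⟧ false c = z≤n

  ·+not· : ∀ b x → b · x + not b · x ≡ x
  ·+not· true  x = +-identityʳ x
  ·+not· false x = refl

  ·-exchange : ∀ a b x → a · b · x ≡ b · a · x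
  ·-exchange true  b     x = refl
  ·-exchange false true  x = refl
  ·-exchange false false x = refl

  ·≡*⟦⟧ : ∀ b x → b · x ≡ x * ⟦ b ⟧
  ·≡*⟦⟧ true  x = sym (*-identityʳ x)
  ·≡*⟦⟧ false x = sym (*-zeroʳ x)

  ·-∑ : ∀ {N} b (f : Fin N → ℕ) → b · sum f ≡ sum (λ i → b · f i)
  ·-∑     true  f = refl
  ·-∑ {N} false f = sym (sum-replicate-zero N)

  ∑-mono-≤ : ∀ {N} {f g : Fin N → ℕ} → (∀ i → f i ≤ g i) → sum f ≤ sum g
  ∑-mono-≤ {zero}  f≤g = z≤n
  ∑-mono-≤ {suc N} f≤g = +-mono-≤ (f≤g zero) (∑-mono-≤ (f≤g ∘ suc))

  ∑-<⇒∃< : ∀ {N} (f g : Fin N → ℕ) → sum f < sum g → ∃ λ i → f i < g i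
  ∑-<⇒∃< {suc N} f g ∑f<∑g with f zero <? g zero
  ... | yes f₀<g₀ = zero , f₀<g₀
  ... | no  f₀≮g₀ with ∑-<⇒∃< (f ∘ suc) (g ∘ suc)
                         (+-cancelˡ-< (g zero) _ _ (≤-<-trans (+-monoˡ-≤ _ (≮⇒≥ f₀≮g₀)) ∑f<∑g))
  ...   | i , fᵢ<gᵢ = suc i , fᵢ<gᵢ

  ∑-const-1 : ∀ N → sum {N} (λ _ → 1) ≡ N
  ∑-const-1 zero    = refl
  ∑-const-1 (suc N) = cong suc (∑-const-1 N)

  ∑-·-const : ∀ {N} (b : Fin N → Bool) x → sum (λ i → b i · x) ≡ x * sum (⟦_⟧ ∘ b)
  ∑-·-const b x = trans (sum-cong-≗ (λ i → ·≡*⟦⟧ (b i) x)) (sym (*-distribˡ-sum x (⟦_⟧ ∘ b)))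

  ∑·∑-comm : ∀ {M N} (a : Fin N → Bool) (b : Fin M → Bool) (w : Fin M → Fin N → ℕ) →
             sum (λ v → a v · sum (λ u → b u · w u v)) ≡ sum (λ u → b u · sum (λ v → a v · w u v))
  ∑·∑-comm a b w = begin
    sum (λ v → a v · sum (λ u → b u · w u v))   ≡⟨ sum-cong-≗ (λ v → ·-∑ (a v) (λ u → b u · w u v)) ⟩
    sum (λ v → sum (λ u → a v · b u · w u v))   ≡⟨ ∑-comm (λ v u → a v · b u · w u v) ⟩
    sum (λ u → sum (λ v → a v · b u · w u v))   ≡⟨ sum-cong-≗ (λ u → sum-cong-≗ (λ v → ·-exchange (a v) (b u) (w u v))) ⟩
    sum (λ u → sum (λ v → b u · a v · w u v))   ≡⟨ sum-cong-≗ (λ u → ·-∑ (b u) (λ v → a v · w u v)) ⟨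
    sum (λ u → b u · sum (λ v → a v · w u v))   ∎
    where open ≡-Reasoning

  ∑-≟· : ∀ {k} (x : Fin k) y → sum (λ j → does (x ≟ j) · y) ≡ y
  ∑-≟· {suc k} zero    y = trans (cong (y +_) (sum-replicate-zero k)) (+-identityʳ y)
  ∑-≟· {suc k} (suc x) y = ∑-≟· x y

  ∑-by-class : ∀ {k N} (c : Fin N → Fin k) (f : Fin N → ℕ) →
               sum f ≡ sum (λ j → sum (λ v → does (c v ≟ j) · f v))
  ∑-by-class c f = trans (sum-cong-≗ (λ v → sym (∑-≟· (c v) (f v)))) (∑-comm (λ v j → does (c v ≟ j) · f v))

  ∑₃ : (f : Fin 3 → ℕ) → sum f ≡ f 0F + f 1F + f 2F
  ∑₃ f = trans (cong (λ x → f 0F + (f 1F + x)) (+-identityʳ (f 2F))) (sym (+-assoc (f 0F) (f 1F) (f 2F)))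

  boolSide-id : ∀ b → boolSide b ≡ b
  boolSide-id true  = refl
  boolSide-id false = refl

  lookup-tabulate-boolSide : ∀ {N} (f : Fin N → Bool) i → lookup (tabulate (boolSide ∘ f)) i ≡ f i
  lookup-tabulate-boolSide f i = trans (lookup∘tabulate (boolSide ∘ f) i) (boolSide-id (f i))

  ∣p∣≡∑ : ∀ {N} (p : Subset N) → ∣ p ∣ ≡ sum (⟦_⟧ ∘ lookup p)
  ∣p∣≡∑ []          = refl
  ∣p∣≡∑ (true ∷ p)  = cong suc (∣p∣≡∑ p)
  ∣p∣≡∑ (false ∷ p) = ∣p∣≡∑ p

  ∣tabulate∣≡∑ : ∀ {N} (f : Fin N → Bool) → ∣ tabulate (boolSide ∘ f) ∣ ≡ sum (⟦_⟧ ∘ f)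
  ∣tabulate∣≡∑ f = trans (∣p∣≡∑ (tabulate (boolSide ∘ f))) (sum-cong-≗ (cong ⟦_⟧ ∘ lookup-tabulate-boolSide f))

  ∣p∩tabulate∣≡∑ : ∀ {N} (p : Subset N) (f : Fin N → Bool) →
                    ∣ p ∩ tabulate (boolSide ∘ f) ∣ ≡ sum (λ i → lookup p i · ⟦ f i ⟧)
  ∣p∩tabulate∣≡∑ p f = trans (∣p∣≡∑ (p ∩ tabulate (boolSide ∘ f))) (sum-cong-≗ λ i →
    trans (cong ⟦_⟧ (trans (lookup-zipWith _∧_ i p _) (cong (lookup p i ∧_) (lookup-tabulate-boolSide f i))))
          (⟦∧⟧ (lookup p i) (f i)))
    where
    ⟦∧⟧ : ∀ a b → ⟦ a ∧ b ⟧ ≡ a · ⟦ b ⟧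
    ⟦∧⟧ true  b = refl
    ⟦∧⟧ false b = refl

module PartArithmetic where

  open import Data.Nat using (ℕ; _+_; _*_; _∸_; _≤_; _<_; _≤?_; _<?_; _≮_; z≤n; NonZero; >-nonZero)
  open import Data.Nat.Properties
  open import Data.Nat.Tactic.RingSolver using (solve)
  open import Data.List using ([]; _∷_)
  open import Data.Empty using (⊥; ⊥-elim)
  open import Data.Product using (∃-syntax; _×_; _,_)
  open import Relation.Binary.PropositionalEquality
  open import Relation.Nullary using (Dec; yes; no)
  open import Algebra.Properties.CommutativeSemigroup +-commutativeSemigroup using (xy∙z≈xz∙y; xy∙z≈zx∙y)

  -- The counts of one part V of an (n + D)-regular balanced tripartite digraph on 3n vertices, for S and
  -- a set T containing every vertex with more than 3n/K inneighbours in S: s = |S ∩ V|, σ = |S ∖ V|,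
  -- t = |T ∩ V|, and e is the number of edges from S into V.
  record PartCounts (n D K S : ℕ) : Set where
    field
      s σ t e   : ℕ
      s+σ≡S     : s + σ ≡ S
      s≤n       : s ≤ n
      t≤n       : t ≤ n
      Ke≤KdT    : K * e ≤ K * ((n + D) * t) + 3 * n * n
      Ke≤KσT    : K * e ≤ K * (σ * t) + 3 * n * n
      σD≤e      : σ * D ≤ e
      deficient : t < n → K * (σ + D) ≤ K * n + 3 * n

  open PartCounts

  record Tripartition (n D K S T : ℕ) : Set where
    field
      p₀ p₁ p₂ : PartCounts n D K S
      ∑s≡S     : s p₀ + s p₁ + s p₂ ≡ S
      ∑t≡T     : t p₀ + t p₁ + t p₂ ≡ T
      ∑e≡dS    : e p₀ + e p₁ + e p₂ ≡ (n + D) * S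

  open Tripartition

  *-slack-mono : ∀ {M K x y c} .{{_ : NonZero M}} → M ≤ K → M * x + c ≤ M * y → K * x + c ≤ K * y
  *-slack-mono {M} {K} {x} {y} {c} M≤K Mx+c≤My = begin
    K * x + c       ≤⟨ +-monoʳ-≤ (K * x) (≤-trans c≤Mz (*-monoˡ-≤ z M≤K)) ⟩
    K * x + K * z   ≡⟨ *-distribˡ-+ K x z ⟨
    K * (x + z)     ≡⟨ cong (K *_) (m+[n∸m]≡n x≤y) ⟩
    K * y           ∎
    where
    open ≤-Reasoning
    x≤y : x ≤ y
    x≤y = *-cancelˡ-≤ M (≤-trans (m≤m+n (M * x) c) Mx+c≤My)
    z = y ∸ x
    c≤Mz : c ≤ M * z
    c≤Mz = +-cancelˡ-≤ (M * x) c (M * z) (begin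
      M * x + c       ≤⟨ Mx+c≤My ⟩
      M * y           ≡⟨ cong (M *_) (m+[n∸m]≡n x≤y) ⟨
      M * (x + z)     ≡⟨ *-distribˡ-+ M x z ⟩
      M * x + M * z   ∎)

  module _ {n D K S T : ℕ} where

    rotate : Tripartition n D K S T → Tripartition n D K S T
    rotate X = record
      { p₀ = p₁ X ; p₁ = p₂ X ; p₂ = p₀ X
      ; ∑s≡S  = trans (xy∙z≈zx∙y (s (p₁ X)) (s (p₂ X)) (s (p₀ X))) (∑s≡S X)
      ; ∑t≡T  = trans (xy∙z≈zx∙y (t (p₁ X)) (t (p₂ X)) (t (p₀ X))) (∑t≡T X)
      ; ∑e≡dS = trans (xy∙z≈zx∙y (e (p₁ X)) (e (p₂ X)) (e (p₀ X))) (∑e≡dS X)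
      }

    swap₁₂ : Tripartition n D K S T → Tripartition n D K S T
    swap₁₂ X = record
      { p₀ = p₀ X ; p₁ = p₂ X ; p₂ = p₁ X
      ; ∑s≡S  = trans (xy∙z≈xz∙y (s (p₀ X)) (s (p₂ X)) (s (p₁ X))) (∑s≡S X)
      ; ∑t≡T  = trans (xy∙z≈xz∙y (t (p₀ X)) (t (p₂ X)) (t (p₁ X))) (∑t≡T X)
      ; ∑e≡dS = trans (xy∙z≈xz∙y (e (p₀ X)) (e (p₂ X)) (e (p₁ X))) (∑e≡dS X)
      }

    noDeficientPart : ∀ {M} .{{_ : NonZero M}} → M ≤ K → M * S + 3 * n ≤ M * (3 * n) → (X : Tripartition n D K S T) →
                      t (p₀ X) ≡ n → t (p₁ X) ≡ n → t (p₂ X) ≡ n → K * S + 3 * n ≤ K * T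
    noDeficientPart M≤K MS+3n≤3Mn X t₀≡n t₁≡n t₂≡n = subst (λ x → K * S + 3 * n ≤ K * x) T≡3n (*-slack-mono M≤K MS+3n≤3Mn)
      where
      T≡3n : 3 * n ≡ T
      T≡3n = begin
        3 * n                             ≡⟨ solve (n ∷ []) ⟩
        n + n + n                         ≡⟨ cong₂ _+_ (cong₂ _+_ t₀≡n t₁≡n) t₂≡n ⟨
        t (p₀ X) + t (p₁ X) + t (p₂ X)    ≡⟨ ∑t≡T X ⟩
        T                                 ∎
        where open ≡-Reasoning

    oneDeficientPart : ∀ {L} → 6 * L ≤ K → n ≤ L * D → (X : Tripartition n D K S T) →
                       t (p₀ X) < n → t (p₁ X) ≡ n → t (p₂ X) ≡ n → K * S + 3 * n ≤ K * T
    oneDeficientPart {L} 6L≤K n≤LD X@record { p₀ = p@record { s = s₀ ; σ = σ₀ ; t = t₀ } } t₀<n t₁≡n t₂≡n = begin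
      K * S + 3 * n                     ≤⟨ +-cancelʳ-≤ (K * D) _ _ bound ⟩
      K * (n + n)                       ≤⟨ *-monoʳ-≤ K (+-monoˡ-≤ n (m≤n+m n t₀)) ⟩
      K * (t₀ + n + n)                  ≡⟨ cong₂ (λ x y → K * (t₀ + x + y)) t₁≡n t₂≡n ⟨
      K * (t₀ + t (p₁ X) + t (p₂ X))    ≡⟨ cong (K *_) (∑t≡T X) ⟩
      K * T                             ∎
      where
      open ≤-Reasoning
      6n≤KD : 6 * n ≤ K * D
      6n≤KD = begin
        6 * n        ≤⟨ *-monoʳ-≤ 6 n≤LD ⟩
        6 * (L * D)  ≡⟨ *-assoc 6 L D ⟨
        6 * L * D    ≤⟨ *-monoˡ-≤ D 6L≤K ⟩
        K * D        ∎
      bound : K * S + 3 * n + K * D ≤ K * (n + n) + K * D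
      bound = begin
        K * S + 3 * n + K * D              ≡⟨ cong (λ x → K * x + 3 * n + K * D) (s+σ≡S p) ⟨
        K * (s₀ + σ₀) + 3 * n + K * D      ≡⟨ solve (K ∷ s₀ ∷ σ₀ ∷ D ∷ n ∷ []) ⟩
        K * s₀ + (K * (σ₀ + D) + 3 * n)    ≤⟨ +-mono-≤ (*-monoʳ-≤ K (s≤n p)) (+-monoˡ-≤ (3 * n) (deficient p t₀<n)) ⟩
        K * n + (K * n + 3 * n + 3 * n)    ≡⟨ solve (K ∷ n ∷ []) ⟩
        K * (n + n) + 6 * n                ≤⟨ +-monoʳ-≤ (K * (n + n)) 6n≤KD ⟩
        K * (n + n) + K * D                ∎

    fewT⇒fewσ : ∀ {L} → 0 < n → n ≤ L * D → (p : PartCounts n D K S) → 2 * L * t p ≤ n → K * σ p ≤ 6 * L * n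
    fewT⇒fewσ {L} 0<n n≤LD p@record { σ = σ ; t = t } 2Lt≤n =
      *-cancelʳ-≤ (K * σ) (6 * L * n) n {{>-nonZero 0<n}} (+-cancelˡ-≤ (K * σ * n) _ _ (begin
        K * σ * n + K * σ * n                ≡⟨ solve (K ∷ σ ∷ n ∷ []) ⟩
        2 * (K * σ) * n                      ≤⟨ *-monoʳ-≤ (2 * (K * σ)) n≤LD ⟩
        2 * (K * σ) * (L * D)                ≡⟨ solve (K ∷ σ ∷ L ∷ D ∷ []) ⟩
        2 * L * (K * (σ * D))                ≤⟨ *-monoʳ-≤ (2 * L) (≤-trans (*-monoʳ-≤ K (σD≤e p)) (Ke≤KσT p)) ⟩
        2 * L * (K * (σ * t) + 3 * n * n)    ≡⟨ solve (L ∷ K ∷ σ ∷ t ∷ n ∷ []) ⟩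
        K * σ * (2 * L * t) + 6 * L * n * n  ≤⟨ +-monoˡ-≤ (6 * L * n * n) (*-monoʳ-≤ (K * σ) 2Lt≤n) ⟩
        K * σ * n + 6 * L * n * n            ∎))
      where open ≤-Reasoning

    S≤σ₀+σ₁ : (X : Tripartition n D K S T) → S ≤ σ (p₀ X) + σ (p₁ X)
    S≤σ₀+σ₁ record { p₀ = p@record { s = s₀ ; σ = σ₀ } ; p₁ = q@record { s = s₁ ; σ = σ₁ } ; p₂ = record { s = s₂ }
                   ; ∑s≡S = ∑s≡S } =
      +-cancelʳ-≤ (s₀ + s₁) S (σ₀ + σ₁) (begin
        S + (s₀ + s₁)                ≤⟨ m≤m+n _ s₂ ⟩
        S + (s₀ + s₁) + s₂           ≡⟨ solve (S ∷ s₀ ∷ s₁ ∷ s₂ ∷ []) ⟩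
        S + (s₀ + s₁ + s₂)           ≡⟨ cong (S +_) ∑s≡S ⟩
        S + S                        ≡⟨ cong₂ _+_ (s+σ≡S p) (s+σ≡S q) ⟨
        s₀ + σ₀ + (s₁ + σ₁)          ≡⟨ solve (s₀ ∷ σ₀ ∷ s₁ ∷ σ₁ ∷ []) ⟩
        σ₀ + σ₁ + (s₀ + s₁)          ∎)
      where open ≤-Reasoning

    twoDeficientParts-smallT : ∀ {L M} → 4 * (L * M) < K → n ≤ L * D → 3 * n ≤ M * S → (X : Tripartition n D K S T) →
                               t (p₀ X) < n → 2 * L * (t (p₀ X) + t (p₁ X)) ≤ n → ⊥
    twoDeficientParts-smallT {L} {M} 4LM<K n≤LD 3n≤MS X@record { p₀ = p ; p₁ = q } tₚ<n 2La≤n =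
      <⇒≱ 4LM<K (*-cancelˡ-≤ (3 * n) {{m*n≢0 3 n}} (begin
        3 * n * K              ≡⟨ *-comm (3 * n) K ⟩
        K * (3 * n)            ≤⟨ *-monoʳ-≤ K 3n≤MS ⟩
        K * (M * S)            ≡⟨ solve (K ∷ M ∷ S ∷ []) ⟩
        M * (K * S)            ≤⟨ *-monoʳ-≤ M KS≤12Ln ⟩
        M * (12 * L * n)       ≡⟨ solve (M ∷ L ∷ n ∷ []) ⟩
        3 * n * (4 * (L * M))  ∎))
      where
      open ≤-Reasoning
      0<n : 0 < n
      0<n = ≤-<-trans z≤n tₚ<n
      instance
        n≢0 : NonZero n
        n≢0 = >-nonZero 0<n
      KS≤12Ln : K * S ≤ 12 * L * n
      KS≤12Ln = begin
        K * S                  ≤⟨ *-monoʳ-≤ K (S≤σ₀+σ₁ X) ⟩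
        K * (σ p + σ q)        ≡⟨ *-distribˡ-+ K (σ p) (σ q) ⟩
        K * σ p + K * σ q      ≤⟨ +-mono-≤ (fewT⇒fewσ {L} 0<n n≤LD p (≤-trans (*-monoʳ-≤ (2 * L) (m≤m+n (t p) (t q))) 2La≤n))
                                            (fewT⇒fewσ {L} 0<n n≤LD q (≤-trans (*-monoʳ-≤ (2 * L) (m≤n+m (t q) (t p))) 2La≤n)) ⟩
        6 * L * n + 6 * L * n  ≡⟨ solve (L ∷ n ∷ []) ⟩
        12 * L * n             ∎

    twoDeficientParts-largeT : ∀ {L} → 9 * L + 24 * (L * L) ≤ 2 * K → n ≤ L * D → (X : Tripartition n D K S T) →
                               t (p₀ X) < n → t (p₁ X) < n → n ≤ 2 * L * (t (p₀ X) + t (p₁ X)) → K * S + 3 * n ≤ K * T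
    twoDeficientParts-largeT {L} hK n≤LD
      record { p₀ = p@record { σ = σp ; t = tp ; e = ep } ; p₁ = q@record { σ = σq ; t = tq ; e = eq }
             ; p₂ = r@record { t = tr ; e = er } ; ∑t≡T = ∑t≡T ; ∑e≡dS = ∑e≡dS }
      tp<n tq<n n≤2La =
      *-cancelˡ-≤ (n + D) {{>-nonZero (≤-trans (≤-<-trans z≤n tp<n) (m≤m+n n D))}}
        (+-cancelʳ-≤ (K * D * (tp + tq)) _ _ (begin
          (n + D) * (K * S + 3 * n) + K * D * (tp + tq)
            ≡⟨ solve (n ∷ D ∷ K ∷ S ∷ tp ∷ tq ∷ []) ⟩
          K * ((n + D) * S) + (3 * n * (n + D) + K * D * (tp + tq))
            ≡⟨ cong (λ x → K * x + (3 * n * (n + D) + K * D * (tp + tq))) ∑e≡dS ⟨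
          K * (ep + eq + er) + (3 * n * (n + D) + K * D * (tp + tq))
            ≡⟨ cong (_+ (3 * n * (n + D) + K * D * (tp + tq))) (trans (*-distribˡ-+ K (ep + eq) er) (cong (_+ K * er) (*-distribˡ-+ K ep eq))) ⟩
          K * ep + K * eq + K * er + (3 * n * (n + D) + K * D * (tp + tq))
            ≤⟨ +-monoˡ-≤ _ (+-mono-≤ (+-mono-≤ (Ke≤KσT p) (Ke≤KσT q)) (Ke≤KdT r)) ⟩
          K * (σp * tp) + 3 * n * n + (K * (σq * tq) + 3 * n * n) + (K * ((n + D) * tr) + 3 * n * n)
            + (3 * n * (n + D) + K * D * (tp + tq))
            ≡⟨ solve (K ∷ σp ∷ σq ∷ tp ∷ tq ∷ tr ∷ n ∷ D ∷ []) ⟩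
          K * (σp + D) * tp + K * (σq + D) * tq + (K * ((n + D) * tr) + 9 * (n * n) + 3 * n * (n + D))
            ≤⟨ +-monoˡ-≤ _ (+-mono-≤ (*-monoˡ-≤ tp (deficient p tp<n)) (*-monoˡ-≤ tq (deficient q tq<n))) ⟩
          (K * n + 3 * n) * tp + (K * n + 3 * n) * tq + (K * ((n + D) * tr) + 9 * (n * n) + 3 * n * (n + D))
            ≡⟨ solve (K ∷ n ∷ D ∷ tp ∷ tq ∷ tr ∷ []) ⟩
          K * n * (tp + tq) + K * ((n + D) * tr) + (3 * n * (tp + tq) + 12 * (n * n) + 3 * (n * D))
            ≤⟨ +-monoʳ-≤ _ (slack (tp + tq) n≤2La) ⟩
          K * n * (tp + tq) + K * ((n + D) * tr) + 2 * K * D * (tp + tq)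
            ≡⟨ solve (K ∷ n ∷ D ∷ tp ∷ tq ∷ tr ∷ []) ⟩
          (n + D) * (K * (tp + tq + tr)) + K * D * (tp + tq)
            ≡⟨ cong (λ x → (n + D) * (K * x) + K * D * (tp + tq)) ∑t≡T ⟩
          (n + D) * (K * T) + K * D * (tp + tq)
            ∎))
      where
      open ≤-Reasoning
      slack : ∀ a → n ≤ 2 * L * a → 3 * n * a + 12 * (n * n) + 3 * (n * D) ≤ 2 * K * D * a
      slack a n≤2La = begin
        3 * n * a + 12 * (n * n) + 3 * (n * D)
          ≤⟨ +-mono-≤ (+-mono-≤ (*-monoˡ-≤ a (*-monoʳ-≤ 3 n≤LD)) (*-monoʳ-≤ 12 (*-mono-≤ n≤LD n≤2La)))
                      (*-monoʳ-≤ 3 (*-monoˡ-≤ D n≤2La)) ⟩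
        3 * (L * D) * a + 12 * (L * D * (2 * L * a)) + 3 * (2 * L * a * D)
          ≡⟨ solve (L ∷ D ∷ a ∷ []) ⟩
        (9 * L + 24 * (L * L)) * D * a
          ≤⟨ *-monoˡ-≤ a (*-monoˡ-≤ D hK) ⟩
        2 * K * D * a
          ∎

    twoDeficientParts : ∀ {L M} → 9 * L + 24 * (L * L) ≤ 2 * K → 4 * (L * M) < K → n ≤ L * D → 3 * n ≤ M * S →
                        (X : Tripartition n D K S T) → t (p₀ X) < n → t (p₁ X) < n → K * S + 3 * n ≤ K * T
    twoDeficientParts {L} {M} hK₁ hK₂ n≤LD 3n≤MS X t₀<n t₁<n with n ≤? 2 * L * (t (p₀ X) + t (p₁ X))
    ... | yes n≤2La = twoDeficientParts-largeT {L} hK₁ n≤LD X t₀<n t₁<n n≤2La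
    ... | no  n≰2La = ⊥-elim (twoDeficientParts-smallT {L} {M} hK₂ n≤LD 3n≤MS X t₀<n (<⇒≤ (≰⇒> n≰2La)))

  -- The reciprocal of ν₀.
  scale : ℕ → ℕ → ℕ
  scale L M = 17 * (L * L * M)

  module _ {L M : ℕ} .{{_ : NonZero L}} .{{_ : NonZero M}} where
    private
      instance
        L*L≢0 : NonZero (L * L)
        L*L≢0 = m*n≢0 L L
        L*M≢0 : NonZero (L * M)
        L*M≢0 = m*n≢0 L M

    M≤scale : M ≤ scale L M
    M≤scale = ≤-trans (m≤n*m M (L * L)) (m≤n*m (L * L * M) 17)

    6L≤scale : 6 * L ≤ scale L M
    6L≤scale = ≤-trans (*-monoˡ-≤ L (m≤m+n 6 11)) (*-monoʳ-≤ 17 (≤-trans (m≤m*n L L) (m≤m*n (L * L) M)))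

    4LM<scale : 4 * (L * M) < scale L M
    4LM<scale = <-≤-trans (*-monoˡ-< (L * M) (m≤m+n 5 12)) (*-monoʳ-≤ 17 (*-monoˡ-≤ M (m≤m*n L L)))

    9L+24L²≤2scale : 9 * L + 24 * (L * L) ≤ 2 * scale L M
    9L+24L²≤2scale = begin
      9 * L + 24 * (L * L)                               ≤⟨ +-monoˡ-≤ (24 * (L * L)) (*-monoʳ-≤ 9 (m≤m*n L L)) ⟩
      9 * (L * L) + 24 * (L * L)                         ≤⟨ +-mono-≤ (*-monoʳ-≤ 9 LL≤LLM) (*-monoʳ-≤ 24 LL≤LLM) ⟩
      9 * (L * L * M) + 24 * (L * L * M)                 ≤⟨ +-monoʳ-≤ (9 * (L * L * M)) (m≤m+n _ (L * L * M)) ⟩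
      9 * (L * L * M) + (24 * (L * L * M) + L * L * M)   ≡⟨ solve (L ∷ M ∷ []) ⟩
      2 * (17 * (L * L * M))                             ∎
      where
      open ≤-Reasoning
      LL≤LLM = m≤m*n (L * L) M

    expansionInequality : ∀ {n D S T} → n ≤ L * D → 3 * n ≤ M * S → M * S + 3 * n ≤ M * (3 * n) →
                          Tripartition n D (scale L M) S T → scale L M * S + 3 * n ≤ scale L M * T
    expansionInequality {n} {D} {S} {T} n≤LD 3n≤MS MS+3n≤3Mn X =
      cases X (t (p₀ X) <? n) (t (p₁ X) <? n) (t (p₂ X) <? n)
      where
      K = scale L M
      full : (p : PartCounts n D K S) → t p ≮ n → t p ≡ n
      full p t≮n = ≤-antisym (t≤n p) (≮⇒≥ t≮n)
      one = oneDeficientPart {L = L} 6L≤scale n≤LD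
      two = twoDeficientParts {L = L} {M} 9L+24L²≤2scale 4LM<scale n≤LD 3n≤MS
      cases : (X : Tripartition n D K S T) → Dec (t (p₀ X) < n) → Dec (t (p₁ X) < n) → Dec (t (p₂ X) < n) →
              K * S + 3 * n ≤ K * T
      cases X (yes t₀<n) (yes t₁<n) _          = two X t₀<n t₁<n
      cases X (yes t₀<n) (no  _)    (yes t₂<n) = two (swap₁₂ X) t₀<n t₂<n
      cases X (no  _)    (yes t₁<n) (yes t₂<n) = two (rotate X) t₁<n t₂<n
      cases X (yes t₀<n) (no  t₁≮n) (no  t₂≮n) = one X t₀<n (full (p₁ X) t₁≮n) (full (p₂ X) t₂≮n)
      cases X (no  t₀≮n) (yes t₁<n) (no  t₂≮n) = one (rotate X) t₁<n (full (p₂ X) t₂≮n) (full (p₀ X) t₀≮n)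
      cases X (no  t₀≮n) (no  t₁≮n) (yes t₂<n) = one (rotate (rotate X)) t₂<n (full (p₀ X) t₀≮n) (full (p₁ X) t₁≮n)
      cases X (no  t₀≮n) (no  t₁≮n) (no  t₂≮n) =
        noDeficientPart M≤scale MS+3n≤3Mn X (full (p₀ X) t₀≮n) (full (p₁ X) t₁≮n) (full (p₂ X) t₂≮n)

  excess : ∀ {L n d} .{{_ : NonZero L}} → L * n + n ≤ L * d → ∃[ D ] d ≡ n + D × n ≤ L * D
  excess {L} {n} {d} Ln+n≤Ld = d ∸ n , sym n+D≡d , +-cancelˡ-≤ (L * n) n (L * (d ∸ n)) (begin
    L * n + n              ≤⟨ Ln+n≤Ld ⟩
    L * d                  ≡⟨ cong (L *_) n+D≡d ⟨
    L * (n + (d ∸ n))      ≡⟨ *-distribˡ-+ L n (d ∸ n) ⟩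
    L * n + L * (d ∸ n)    ∎)
    where
    open ≤-Reasoning
    n+D≡d : n + (d ∸ n) ≡ d
    n+D≡d = m+[n∸m]≡n (*-cancelˡ-≤ L (≤-trans (m≤m+n (L * n) n) Ln+n≤Ld))

module Counting where

  open import Data.Bool using (Bool; true; false; not)
  open import Data.Nat using (ℕ; _+_; _*_; _≤_; _<_; z≤n)
  open import Data.Nat.Properties hiding (_≟_)
  open import Data.Nat.Tactic.RingSolver using (solve)
  open import Data.List using ([]; _∷_)
  open import Data.Fin using (Fin; _≟_)
  open import Data.Fin.Patterns using (0F; 1F; 2F)
  open import Data.Fin.Subset using (Subset; ∣_∣; _∩_)
  open import Data.Vec using (lookup)
  open import Data.Product using (_×_; _,_; proj₁; proj₂)
  open import Data.Empty using (⊥-elim)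
  open import Function using (_∘_)
  open import Relation.Binary.PropositionalEquality
  open import Relation.Nullary using (does; yes; no)
  open import Algebra.Properties.CommutativeSemigroup +-commutativeSemigroup using (x∙yz≈y∙xz)
  open import Defs
  open Sums
  open PartArithmetic using (PartCounts; Tripartition)

  module InGraph {n D : ℕ} (G : Digraph (3 * n)) (BT : BalancedTripartite n G) (reg : Regular G (n + D))
                 (S T : Subset (3 * n)) (K : ℕ)
                 (sparse : ∀ v → lookup T v ≡ false → K * ∣ S ∩ inNbhd G v ∣ ≤ 3 * n) where
    open BalancedTripartite BT

    N : ℕ
    N = 3 * n

    inV : Fin 3 → Fin N → Bool
    inV j v = does (part v ≟ j)

    inS inT : Fin N → Bool
    inS = lookup S
    inT = lookup T

    degS : Fin N → ℕ
    degS v = ∑[ u < N ] (inS u · ⟦ G u v ⟧)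

    s σ t e : Fin 3 → ℕ
    s j = ∑[ u < N ] (inV j u · ⟦ inS u ⟧)
    σ j = ∑[ u < N ] (not (inV j u) · ⟦ inS u ⟧)
    t j = ∑[ v < N ] (inV j v · ⟦ inT v ⟧)
    e j = ∑[ v < N ] (inV j v · degS v)

    ∣V∣ : ∀ j → ∑[ v < N ] ⟦ inV j v ⟧ ≡ n
    ∣V∣ j = trans (sym (∣tabulate∣≡∑ (inV j))) (partSize j)

    outdeg : ∀ u → ∑[ v < N ] ⟦ G u v ⟧ ≡ n + D
    outdeg u = trans (sym (∣tabulate∣≡∑ (G u))) (proj₁ (reg u))

    indeg : ∀ v → ∑[ u < N ] ⟦ G u v ⟧ ≡ n + D
    indeg v = trans (sym (∣tabulate∣≡∑ (λ u → G u v))) (proj₂ (reg v))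

    ∣S∩N⁻∣≡degS : ∀ v → ∣ S ∩ inNbhd G v ∣ ≡ degS v
    ∣S∩N⁻∣≡degS v = ∣p∩tabulate∣≡∑ S (λ u → G u v)

    edge⇒≢ : ∀ {u v} → G u v ≡ true → part u ≢ part v
    edge⇒≢ {u} {v} uv pu≡pv with trans (sym uv) (independent u v pu≡pv)
    ... | ()

    ∣outside∣ : ∀ j → ∑[ v < N ] ⟦ not (inV j v) ⟧ ≡ n + n
    ∣outside∣ j = +-cancelˡ-≡ n _ _ (begin
      n + X                                                     ≡⟨ cong (_+ X) (∣V∣ j) ⟨
      ∑[ v < N ] ⟦ inV j v ⟧ + X                                ≡⟨ ∑-distrib-+ (⟦_⟧ ∘ inV j) (⟦_⟧ ∘ not ∘ inV j) ⟨
      ∑[ v < N ] (⟦ inV j v ⟧ + ⟦ not (inV j v) ⟧)              ≡⟨ sum-cong-≗ {N} (⟦⟧+⟦not⟧ ∘ inV j) ⟩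
      ∑[ v < N ] 1                                              ≡⟨ ∑-const-1 N ⟩
      n + (n + (n + 0))                                         ≡⟨ solve (n ∷ []) ⟩
      n + (n + n)                                               ∎)
      where
      open ≡-Reasoning
      X = ∑[ v < N ] ⟦ not (inV j v) ⟧

    ∣outside-both∣ : ∀ {i j} → i ≢ j → ∑[ v < N ] (not (inV j v) · ⟦ not (inV i v) ⟧) ≡ n
    ∣outside-both∣ {i} {j} i≢j = +-cancelˡ-≡ (n + n) _ _ (begin
      n + n + X                                                 ≡⟨ cong₂ (λ a b → a + b + X) (∣V∣ j) (∣V∣ i) ⟨
      ∑[ v < N ] ⟦ inV j v ⟧ + ∑[ v < N ] ⟦ inV i v ⟧ + X       ≡⟨ cong (_+ X) (∑-distrib-+ (⟦_⟧ ∘ inV j) (⟦_⟧ ∘ inV i)) ⟨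
      ∑[ v < N ] (⟦ inV j v ⟧ + ⟦ inV i v ⟧) + X                ≡⟨ ∑-distrib-+ (λ v → ⟦ inV j v ⟧ + ⟦ inV i v ⟧) neither ⟨
      ∑[ v < N ] (⟦ inV j v ⟧ + ⟦ inV i v ⟧ + neither v)        ≡⟨ sum-cong-≗ {N} partition ⟩
      ∑[ v < N ] 1                                              ≡⟨ ∑-const-1 N ⟩
      n + (n + (n + 0))                                         ≡⟨ solve (n ∷ []) ⟩
      n + n + n                                                 ∎)
      where
      open ≡-Reasoning
      neither : Fin N → ℕ
      neither v = not (inV j v) · ⟦ not (inV i v) ⟧
      X = ∑[ v < N ] neither v
      partition : ∀ v → ⟦ inV j v ⟧ + ⟦ inV i v ⟧ + neither v ≡ 1
      partition v with part v ≟ j | part v ≟ i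
      ... | yes v∈j | yes v∈i = ⊥-elim (i≢j (trans (sym v∈i) v∈j))
      ... | yes _   | no  _   = refl
      ... | no  _   | yes _   = refl
      ... | no  _   | no  _   = refl

    -- u has n + D outneighbours, none in its own part, and only n vertices lie outside both V_j and that part.
    edgesInto : ∀ j u → part u ≢ j → D ≤ ∑[ v < N ] (inV j v · ⟦ G u v ⟧)
    edgesInto j u u∉j = +-cancelˡ-≤ n D _ (begin
      n + D                                                     ≡⟨ outdeg u ⟨
      ∑[ v < N ] ⟦ G u v ⟧                                      ≤⟨ ∑-mono-≤ {N} split ⟩
      ∑[ v < N ] (into v + outside v)                           ≡⟨ ∑-distrib-+ into outside ⟩
      ∑[ v < N ] into v + ∑[ v < N ] outside v                  ≡⟨ cong (∑[ v < N ] into v +_) (∣outside-both∣ u∉j) ⟩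
      ∑[ v < N ] into v + n                                     ≡⟨ +-comm _ n ⟩
      n + ∑[ v < N ] into v                                     ∎)
      where
      open ≤-Reasoning
      into outside : Fin N → ℕ
      into v = inV j v · ⟦ G u v ⟧
      outside v = not (inV j v) · ⟦ not (inV (part u) v) ⟧
      split : ∀ v → ⟦ G u v ⟧ ≤ into v + outside v
      split v with G u v in uv | part v ≟ j | part v ≟ part u
      ... | false | _     | _       = z≤n
      ... | true  | yes _ | _       = m≤m+n 1 _
      ... | true  | no  _ | yes v∈u = ⊥-elim (edge⇒≢ uv (sym v∈u))
      ... | true  | no  _ | no  _   = ≤-refl

    σD≤e : ∀ j → σ j * D ≤ e j
    σD≤e j = begin
      σ j * D                                                   ≡⟨ *-distribʳ-sum D (λ u → not (inV j u) · ⟦ inS u ⟧) ⟩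
      ∑[ u < N ] ((not (inV j u) · ⟦ inS u ⟧) * D)              ≤⟨ ∑-mono-≤ {N} atVertex ⟩
      ∑[ u < N ] (inS u · ∑[ v < N ] (inV j v · ⟦ G u v ⟧))     ≡⟨ ∑·∑-comm (inV j) inS (λ u v → ⟦ G u v ⟧) ⟨
      e j                                                       ∎
      where
      open ≤-Reasoning
      atVertex : ∀ u → (not (inV j u) · ⟦ inS u ⟧) * D ≤ inS u · ∑[ v < N ] (inV j v · ⟦ G u v ⟧)
      atVertex u with part u ≟ j | inS u
      ... | yes _   | _     = z≤n
      ... | no  _   | false = z≤n
      ... | no  u∉j | true  = ≤-trans (≤-reflexive (+-identityʳ D)) (edgesInto j u u∉j)

    degS≤σ : ∀ {j v} → part v ≡ j → degS v ≤ σ j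
    degS≤σ {j} {v} v∈j = ∑-mono-≤ {N} atVertex
      where
      atVertex : ∀ u → inS u · ⟦ G u v ⟧ ≤ not (inV j u) · ⟦ inS u ⟧
      atVertex u with part u ≟ j | inS u | G u v in uv
      ... | yes u∈j | true  | true  = ⊥-elim (edge⇒≢ uv (trans u∈j (sym v∈j)))
      ... | yes _   | true  | false = z≤n
      ... | yes _   | false | _     = z≤n
      ... | no  _   | true  | g     = ⟦⟧≤1 g
      ... | no  _   | false | _     = z≤n

    degS≤d : ∀ v → degS v ≤ n + D
    degS≤d v = ≤-trans (∑-mono-≤ {N} (λ u → ·≤ (inS u) ⟦ G u v ⟧)) (≤-reflexive (indeg v))

    Ke≤Kct+Nn : ∀ j c → (∀ {v} → part v ≡ j → inT v ≡ true → degS v ≤ c) → K * e j ≤ K * (c * t j) + N * n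
    Ke≤Kct+Nn j c bound = begin
      K * e j                                                   ≡⟨ *-distribˡ-sum K (λ v → inV j v · degS v) ⟩
      ∑[ v < N ] (K * (inV j v · degS v))                       ≤⟨ ∑-mono-≤ {N} atVertex ⟩
      ∑[ v < N ] (Kct v + inV j v · N)                          ≡⟨ ∑-distrib-+ Kct (λ v → inV j v · N) ⟩
      ∑[ v < N ] Kct v + ∑[ v < N ] (inV j v · N)               ≡⟨ cong₂ _+_ ∑Kct ∑N ⟩
      K * (c * t j) + N * n                                     ∎
      where
      open ≤-Reasoning
      Kct : Fin N → ℕ
      Kct v = K * (c * (inV j v · ⟦ inT v ⟧))
      ∑Kct : ∑[ v < N ] Kct v ≡ K * (c * t j)
      ∑Kct = sym (trans (cong (K *_) (*-distribˡ-sum c (λ v → inV j v · ⟦ inT v ⟧))) (*-distribˡ-sum K (λ v → c * (inV j v · ⟦ inT v ⟧))))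
      ∑N : ∑[ v < N ] (inV j v · N) ≡ N * n
      ∑N = trans (∑-·-const (inV j) N) (cong (N *_) (∣V∣ j))
      atVertex : ∀ v → K * (inV j v · degS v) ≤ Kct v + inV j v · N
      atVertex v with part v ≟ j | inT v in vT
      ... | no  _   | _     = ≤-trans (≤-reflexive (*-zeroʳ K)) z≤n
      ... | yes v∈j | true  = ≤-trans (*-monoʳ-≤ K (≤-trans (bound v∈j vT) (≤-reflexive (sym (*-identityʳ c))))) (m≤m+n _ N)
      ... | yes _   | false = ≤-trans (subst (λ x → K * x ≤ N) (∣S∩N⁻∣≡degS v) (sparse v vT)) (m≤n+m N (K * (c * 0)))

    missed : ∀ j v → inV j v · ⟦ inT v ⟧ < ⟦ inV j v ⟧ → part v ≡ j × inT v ≡ false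
    missed j v lt with part v ≟ j | inT v
    ... | yes v∈j | false = v∈j , refl
    ... | yes _   | true  = ⊥-elim (<-irrefl refl lt)
    ... | no  _   | _     = ⊥-elim (n≮0 lt)

    -- The n + D inneighbours of v lie among the 2n vertices outside V_j.
    σ+D≤degS+n : ∀ {j v} → part v ≡ j → σ j + D ≤ degS v + n
    σ+D≤degS+n {j} {v} v∈j = +-cancelˡ-≤ n _ _ (begin
      n + (σ j + D)                                             ≡⟨ x∙yz≈y∙xz n (σ j) D ⟩
      σ j + (n + D)                                             ≡⟨ cong (σ j +_) (indeg v) ⟨
      σ j + ∑[ u < N ] ⟦ G u v ⟧                                ≡⟨ ∑-distrib-+ (λ u → not (inV j u) · ⟦ inS u ⟧) (λ u → ⟦ G u v ⟧) ⟨
      ∑[ u < N ] (not (inV j u) · ⟦ inS u ⟧ + ⟦ G u v ⟧)        ≤⟨ ∑-mono-≤ {N} atVertex ⟩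
      ∑[ u < N ] (inS u · ⟦ G u v ⟧ + ⟦ not (inV j u) ⟧)        ≡⟨ ∑-distrib-+ (λ u → inS u · ⟦ G u v ⟧) (λ u → ⟦ not (inV j u) ⟧) ⟩
      degS v + ∑[ u < N ] ⟦ not (inV j u) ⟧                     ≡⟨ cong (degS v +_) (∣outside∣ j) ⟩
      degS v + (n + n)                                          ≡⟨ x∙yz≈y∙xz (degS v) n n ⟩
      n + (degS v + n)                                          ∎)
      where
      open ≤-Reasoning
      atVertex : ∀ u → not (inV j u) · ⟦ inS u ⟧ + ⟦ G u v ⟧ ≤ inS u · ⟦ G u v ⟧ + ⟦ not (inV j u) ⟧
      atVertex u with part u ≟ j | inS u | G u v in uv
      ... | yes u∈j | _     | true  = ⊥-elim (edge⇒≢ uv (trans u∈j (sym v∈j)))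
      ... | yes _   | _     | false = z≤n
      ... | no  _   | false | g     = ⟦⟧≤1 g
      ... | no  _   | true  | g     = ≤-reflexive (+-comm 1 ⟦ g ⟧)

    deficient : ∀ j → t j < n → K * (σ j + D) ≤ K * n + N
    deficient j t<n with ∑-<⇒∃< (λ v → inV j v · ⟦ inT v ⟧) (⟦_⟧ ∘ inV j) (subst (t j <_) (sym (∣V∣ j)) t<n)
    ... | v , lt with missed j v lt
    ...   | v∈j , v∉T = begin
      K * (σ j + D)         ≤⟨ *-monoʳ-≤ K (σ+D≤degS+n v∈j) ⟩
      K * (degS v + n)      ≡⟨ *-distribˡ-+ K (degS v) n ⟩
      K * degS v + K * n    ≤⟨ +-monoˡ-≤ (K * n) (subst (λ x → K * x ≤ N) (∣S∩N⁻∣≡degS v) (sparse v v∉T)) ⟩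
      N + K * n             ≡⟨ +-comm N (K * n) ⟩
      K * n + N             ∎
      where open ≤-Reasoning

    partCounts : Fin 3 → PartCounts n D K ∣ S ∣
    partCounts j = record
      { s = s j ; σ = σ j ; t = t j ; e = e j
      ; s+σ≡S     = trans (sym (∑-distrib-+ (λ u → inV j u · ⟦ inS u ⟧) (λ u → not (inV j u) · ⟦ inS u ⟧)))
                          (trans (sum-cong-≗ {N} (λ u → ·+not· (inV j u) ⟦ inS u ⟧)) (sym (∣p∣≡∑ S)))
      ; s≤n       = ≤-trans (∑-mono-≤ {N} (λ u → ·⟦⟧≤⟦⟧ (inV j u) (inS u))) (≤-reflexive (∣V∣ j))
      ; t≤n       = ≤-trans (∑-mono-≤ {N} (λ v → ·⟦⟧≤⟦⟧ (inV j v) (inT v))) (≤-reflexive (∣V∣ j))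
      ; Ke≤KdT    = Ke≤Kct+Nn j (n + D) (λ {v} _ _ → degS≤d v)
      ; Ke≤KσT    = Ke≤Kct+Nn j (σ j) (λ v∈j _ → degS≤σ v∈j)
      ; σD≤e      = σD≤e j
      ; deficient = deficient j
      }

    ∑e≡d∣S∣ : e 0F + e 1F + e 2F ≡ (n + D) * ∣ S ∣
    ∑e≡d∣S∣ = begin
      e 0F + e 1F + e 2F                                ≡⟨ trans (∑-by-class part degS) (∑₃ e) ⟨
      ∑[ v < N ] degS v                                 ≡⟨ ∑·∑-comm (λ _ → true) inS (λ u v → ⟦ G u v ⟧) ⟩
      ∑[ u < N ] (inS u · ∑[ v < N ] ⟦ G u v ⟧)         ≡⟨ sum-cong-≗ {N} (λ u → cong (inS u ·_) (outdeg u)) ⟩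
      ∑[ u < N ] (inS u · (n + D))                      ≡⟨ ∑-·-const inS (n + D) ⟩
      (n + D) * ∑[ u < N ] ⟦ inS u ⟧                    ≡⟨ cong ((n + D) *_) (∣p∣≡∑ S) ⟨
      (n + D) * ∣ S ∣                                   ∎
      where open ≡-Reasoning

    tripartition : Tripartition n D K ∣ S ∣ ∣ T ∣
    tripartition = record
      { p₀ = partCounts 0F ; p₁ = partCounts 1F ; p₂ = partCounts 2F
      ; ∑s≡S  = sym (trans (∣p∣≡∑ S) (trans (∑-by-class part (⟦_⟧ ∘ inS)) (∑₃ s)))
      ; ∑t≡T  = sym (trans (∣p∣≡∑ T) (trans (∑-by-class part (⟦_⟧ ∘ inT)) (∑₃ t)))
      ; ∑e≡dS = ∑e≡d∣S∣
      }

module UnitFractions where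

  open import Data.Nat as ℕ using (ℕ; zero; suc; z≤n; s≤s)
  import Data.Nat.Properties as ℕ
  open import Data.Nat.Coprimality using (1-coprimeTo) renaming (sym to coprime-sym)
  open import Data.Integer as ℤ using (+≤+; +<+)
  import Data.Integer.Properties as ℤ
  open import Data.Rational
  open import Data.Rational.Properties
  open import Data.Product using (∃-syntax; _,_)
  open import Data.Empty using (⊥-elim)
  open import Function using (_⇔_; mk⇔; Equivalence)
  open import Relation.Binary.PropositionalEquality
  open import Relation.Nullary using (¬_; yes; no)
  open import Defs using (ℕ→ℚ)

  1/[1+_] : ℕ → ℚ
  1/[1+ k ] = mkℚ (ℤ.+ 1) k (1-coprimeTo (suc k))

  ℕ→ℚ≡mkℚ : ∀ x → ℕ→ℚ x ≡ mkℚ (ℤ.+ x) 0 (coprime-sym (1-coprimeTo x))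
  ℕ→ℚ≡mkℚ x = normalize-coprime (coprime-sym (1-coprimeTo x))

  ℕ→ℚ-+ : ∀ x y → ℕ→ℚ (x ℕ.+ y) ≡ ℕ→ℚ x + ℕ→ℚ y
  ℕ→ℚ-+ x y rewrite ℕ→ℚ≡mkℚ x | ℕ→ℚ≡mkℚ y =
    cong (_/ 1) (sym (cong₂ ℤ._+_ (ℤ.*-identityʳ (ℤ.+ x)) (ℤ.*-identityʳ (ℤ.+ y))))

  ℕ→ℚ-* : ∀ x y → ℕ→ℚ (x ℕ.* y) ≡ ℕ→ℚ x * ℕ→ℚ y
  ℕ→ℚ-* x y rewrite ℕ→ℚ≡mkℚ x | ℕ→ℚ≡mkℚ y = cong (_/ 1) (ℤ.pos-* x y)

  ℕ→ℚ-mono-≤ : ∀ {x y} → x ℕ.≤ y → ℕ→ℚ x ≤ ℕ→ℚ y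
  ℕ→ℚ-mono-≤ {x} {y} x≤y rewrite ℕ→ℚ≡mkℚ x | ℕ→ℚ≡mkℚ y =
    *≤* (subst₂ ℤ._≤_ (sym (ℤ.*-identityʳ (ℤ.+ x))) (sym (ℤ.*-identityʳ (ℤ.+ y))) (+≤+ x≤y))

  ℕ→ℚ-cancel-≤ : ∀ {x y} → ℕ→ℚ x ≤ ℕ→ℚ y → x ℕ.≤ y
  ℕ→ℚ-cancel-≤ {x} {y} rewrite ℕ→ℚ≡mkℚ x | ℕ→ℚ≡mkℚ y = λ where
    (*≤* x≤y) → ℤ.drop‿+≤+ (subst₂ ℤ._≤_ (ℤ.*-identityʳ (ℤ.+ x)) (ℤ.*-identityʳ (ℤ.+ y)) x≤y)

  ℕ→ℚ-nonNeg : ∀ x → NonNegative (ℕ→ℚ x)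
  ℕ→ℚ-nonNeg x = normalize-nonNeg x 1

  ℕ→ℚ[1+k]*1/[1+k]≡1 : ∀ k → ℕ→ℚ (suc k) * 1/[1+ k ] ≡ 1ℚ
  ℕ→ℚ[1+k]*1/[1+k]≡1 k rewrite ℕ→ℚ≡mkℚ (suc k) =
    *-inverseʳ (mkℚ (ℤ.+ suc k) 0 (coprime-sym (1-coprimeTo (suc k))))

  ℕ→ℚ-scale : ∀ k x y → ℕ→ℚ (suc k) * (ℕ→ℚ x + 1/[1+ k ] * ℕ→ℚ y) ≡ ℕ→ℚ (suc k ℕ.* x ℕ.+ y)
  ℕ→ℚ-scale k x y = begin
    K * (ℕ→ℚ x + 1/[1+ k ] * ℕ→ℚ y)          ≡⟨ *-distribˡ-+ K (ℕ→ℚ x) _ ⟩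
    K * ℕ→ℚ x + K * (1/[1+ k ] * ℕ→ℚ y)      ≡⟨ cong ((K * ℕ→ℚ x) +_) (*-assoc K 1/[1+ k ] (ℕ→ℚ y)) ⟨
    K * ℕ→ℚ x + K * 1/[1+ k ] * ℕ→ℚ y        ≡⟨ cong (λ r → K * ℕ→ℚ x + r * ℕ→ℚ y) (ℕ→ℚ[1+k]*1/[1+k]≡1 k) ⟩
    K * ℕ→ℚ x + 1ℚ * ℕ→ℚ y                   ≡⟨ cong ((K * ℕ→ℚ x) +_) (*-identityˡ (ℕ→ℚ y)) ⟩
    K * ℕ→ℚ x + ℕ→ℚ y                        ≡⟨ cong (_+ ℕ→ℚ y) (ℕ→ℚ-* (suc k) x) ⟨
    ℕ→ℚ (suc k ℕ.* x) + ℕ→ℚ y                ≡⟨ ℕ→ℚ-+ (suc k ℕ.* x) y ⟨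
    ℕ→ℚ (suc k ℕ.* x ℕ.+ y)                  ∎
    where
    open ≡-Reasoning
    K = ℕ→ℚ (suc k)

  +1/[1+]*-≤⇔ : ∀ k x y z → (ℕ→ℚ x + 1/[1+ k ] * ℕ→ℚ y ≤ ℕ→ℚ z) ⇔ (suc k ℕ.* x ℕ.+ y ℕ.≤ suc k ℕ.* z)
  +1/[1+]*-≤⇔ k x y z = mk⇔
    (λ h → ℕ→ℚ-cancel-≤ (subst₂ _≤_ (ℕ→ℚ-scale k x y) (sym (ℕ→ℚ-* (suc k) z))
                                    (*-monoˡ-≤-nonNeg (ℕ→ℚ (suc k)) {{ℕ→ℚ-nonNeg (suc k)}} h)))
    (λ h → *-cancelˡ-≤-pos (ℕ→ℚ (suc k)) {{normalize-pos (suc k) 1}}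
             (subst₂ _≤_ (sym (ℕ→ℚ-scale k x y)) (ℕ→ℚ-* (suc k) z) (ℕ→ℚ-mono-≤ {suc k ℕ.* x ℕ.+ y} {suc k ℕ.* z} h)))

  1/[1+]*-≤⇔ : ∀ k y z → (1/[1+ k ] * ℕ→ℚ y ≤ ℕ→ℚ z) ⇔ (y ℕ.≤ suc k ℕ.* z)
  1/[1+]*-≤⇔ k y z = mk⇔
    (λ h → subst (ℕ._≤ _) K*0+y≡y (Equivalence.to (+1/[1+]*-≤⇔ k 0 y z) (subst (_≤ ℕ→ℚ z) (sym (+-identityˡ _)) h)))
    (λ h → subst (_≤ ℕ→ℚ z) (+-identityˡ _) (Equivalence.from (+1/[1+]*-≤⇔ k 0 y z) (subst (ℕ._≤ _) (sym K*0+y≡y) h)))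
    where
    K*0+y≡y : suc k ℕ.* 0 ℕ.+ y ≡ y
    K*0+y≡y = cong (ℕ._+ y) (ℕ.*-zeroʳ k)

  positive⇒1/[1+]≤ : ∀ {q} → 0ℚ < q → ∃[ k ] 1/[1+ k ] ≤ q
  positive⇒1/[1+]≤ {mkℚ (ℤ.+ suc a) k _} _ = k , *≤* (+≤+ (ℕ.*-monoˡ-≤ (suc k) (s≤s {0} {a} z≤n)))
  positive⇒1/[1+]≤ {mkℚ (ℤ.+ zero) _ _} (*<* (+<+ ()))
  positive⇒1/[1+]≤ {mkℚ ℤ.-[1+ _ ] _ _} (*<* ())

  1/[1+]-pos : ∀ k → 0ℚ < 1/[1+ k ]
  1/[1+]-pos k = *<* (+<+ (s≤s z≤n))

  1/[1+]-antimono : ∀ {k m} → m ℕ.≤ k → 1/[1+ k ] ≤ 1/[1+ m ]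
  1/[1+]-antimono m≤k = *≤* (+≤+ (ℕ.*-monoʳ-≤ 1 (s≤s m≤k)))

  1/[1+]≤⇒≤* : ∀ {m q} y z → 1/[1+ m ] ≤ q → q * ℕ→ℚ y ≤ ℕ→ℚ z → y ℕ.≤ suc m ℕ.* z
  1/[1+]≤⇒≤* {m} {q} y z r≤q qy≤z =
    Equivalence.to (1/[1+]*-≤⇔ m y z) (≤-trans (*-monoʳ-≤-nonNeg (ℕ→ℚ y) {{ℕ→ℚ-nonNeg y}} r≤q) qy≤z)

  1/[1+]≤⇒[1+]*≤ : ∀ {l q} n d → 1/[1+ l ] ≤ q → (1ℚ + q) * ℕ→ℚ n ≤ ℕ→ℚ d → suc l ℕ.* n ℕ.+ n ℕ.≤ suc l ℕ.* d
  1/[1+]≤⇒[1+]*≤ {l} {q} n d r≤q [1+q]n≤d = Equivalence.to (+1/[1+]*-≤⇔ l n n d) (begin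
    ℕ→ℚ n + 1/[1+ l ] * ℕ→ℚ n   ≤⟨ +-monoʳ-≤ (ℕ→ℚ n) (*-monoʳ-≤-nonNeg (ℕ→ℚ n) {{ℕ→ℚ-nonNeg n}} r≤q) ⟩
    ℕ→ℚ n + q * ℕ→ℚ n           ≡⟨ cong (_+ q * ℕ→ℚ n) (*-identityˡ (ℕ→ℚ n)) ⟨
    1ℚ * ℕ→ℚ n + q * ℕ→ℚ n      ≡⟨ *-distribʳ-+ (ℕ→ℚ n) 1ℚ q ⟨
    (1ℚ + q) * ℕ→ℚ n            ≤⟨ [1+q]n≤d ⟩
    ℕ→ℚ d                       ∎)
    where open ≤-Reasoning

  1/[1+]≤⇒≤[1-]* : ∀ {m q} x y → 1/[1+ m ] ≤ q → ℕ→ℚ x ≤ (1ℚ - q) * ℕ→ℚ y → suc m ℕ.* x ℕ.+ y ℕ.≤ suc m ℕ.* y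
  1/[1+]≤⇒≤[1-]* {m} {q} x y r≤q x≤[1-q]y = Equivalence.to (+1/[1+]*-≤⇔ m x y y) (begin
    ℕ→ℚ x + 1/[1+ m ] * ℕ→ℚ y       ≤⟨ +-mono-≤ x≤[1-q]y (*-monoʳ-≤-nonNeg (ℕ→ℚ y) {{ℕ→ℚ-nonNeg y}} r≤q) ⟩
    (1ℚ - q) * ℕ→ℚ y + q * ℕ→ℚ y    ≡⟨ *-distribʳ-+ (ℕ→ℚ y) (1ℚ - q) q ⟨
    (1ℚ - q + q) * ℕ→ℚ y            ≡⟨ cong (_* ℕ→ℚ y) 1-q+q≡1 ⟩
    1ℚ * ℕ→ℚ y                      ≡⟨ *-identityˡ (ℕ→ℚ y) ⟩
    ℕ→ℚ y                           ∎)
    where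
    open ≤-Reasoning
    1-q+q≡1 : 1ℚ - q + q ≡ 1ℚ
    1-q+q≡1 = trans (+-assoc 1ℚ (- q) q) (trans (cong (1ℚ +_) (+-inverseˡ q)) (+-identityʳ 1ℚ))

  below-threshold : ∀ {k ν} N f → ν ≤ 1/[1+ k ] → ¬ (ν * ℕ→ℚ N ≤ ℕ→ℚ f) → suc k ℕ.* f ℕ.≤ N
  below-threshold {k} {ν} N f ν≤r νN≰f with suc k ℕ.* f ℕ.≤? N
  ... | yes Kf≤N = Kf≤N
  ... | no  Kf≰N = ⊥-elim (νN≰f (≤-trans (*-monoʳ-≤-nonNeg (ℕ→ℚ N) {{ℕ→ℚ-nonNeg N}} ν≤r)
                                           (Equivalence.from (1/[1+]*-≤⇔ k N f) (ℕ.<⇒≤ (ℕ.≰⇒> Kf≰N)))))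

  above-threshold : ∀ {k ν} x N z → ν ≤ 1/[1+ k ] → suc k ℕ.* x ℕ.+ N ℕ.≤ suc k ℕ.* z → ℕ→ℚ x + ν * ℕ→ℚ N ≤ ℕ→ℚ z
  above-threshold {k} x N z ν≤r Kx+N≤Kz =
    ≤-trans (+-monoʳ-≤ (ℕ→ℚ x) (*-monoʳ-≤-nonNeg (ℕ→ℚ N) {{ℕ→ℚ-nonNeg N}} ν≤r))
            (Equivalence.from (+1/[1+]*-≤⇔ k x N z) Kx+N≤Kz)

module Outexpansion where

  open import Data.Nat as ℕ using (ℕ; suc; pred; _*_)
  open import Data.Rational using (_≤_)
  import Data.Rational as ℚ
  open import Data.Bool using (false)
  open import Data.Fin.Subset using (∣_∣; _∩_)
  open import Data.Vec using (lookup)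
  open import Function using (case_of_)
  open import Relation.Binary.PropositionalEquality
  open import Relation.Nullary.Decidable using (dec-true)
  open import Defs
  open Sums using (lookup-tabulate-boolSide)
  open PartArithmetic using (scale; expansionInequality)
  open UnitFractions

  expandsRobustly : ∀ {l m ν τ n D} → 1/[1+ m ] ≤ τ → ν ≤ 1/[1+ pred (scale (suc l) (suc m)) ] →
                    (G : Digraph (3 * n)) → BalancedTripartite n G → Regular G (n ℕ.+ D) → n ℕ.≤ suc l * D →
                    RobustOutexpander ν τ G
  expandsRobustly {l} {m} {ν} {n = n} 1/M≤τ ν≤1/K G BT reg n≤LD S τN≤∣S∣ ∣S∣≤[1-τ]N =
    above-threshold (∣ S ∣) (3 * n) (∣ T ∣) ν≤1/K
      (expansionInequality {suc l} {suc m} n≤LD (1/[1+]≤⇒≤* (3 * n) (∣ S ∣) 1/M≤τ τN≤∣S∣)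
                           (1/[1+]≤⇒≤[1-]* (∣ S ∣) (3 * n) 1/M≤τ ∣S∣≤[1-τ]N) tripartition)
    where
    T = RN⁺ ν G S
    sparse : ∀ v → lookup T v ≡ false → scale (suc l) (suc m) * ∣ S ∩ inNbhd G v ∣ ℕ.≤ 3 * n
    sparse v v∉T = below-threshold (3 * n) (∣ S ∩ inNbhd G v ∣) ν≤1/K λ νN≤f →
      case trans (sym (dec-true (_ ℚ.≤? _) νN≤f)) (trans (sym (lookup-tabulate-boolSide _ v)) v∉T) of λ ()
    open Counting.InGraph G BT reg S T (scale (suc l) (suc m)) sparse

open import Defs
open import Data.Nat using (ℕ; _*_)
open import Data.Rational using (ℚ; 0ℚ; 1ℚ; ½; _<_; _≤_; _+_)
open import Data.Product using (_×_; ∃-syntax)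
open import Data.Nat using () renaming (_≤_ to _≤ℕ_)
open import Data.Nat using (suc; pred; s≤s⁻¹)
open import Data.Product using (_,_)
open import Relation.Binary.PropositionalEquality using (subst)
import Data.Rational.Properties as ℚ
open PartArithmetic using (scale; M≤scale; excess)
open UnitFractions using (1/[1+_]; positive⇒1/[1+]≤; 1/[1+]-pos; 1/[1+]-antimono; 1/[1+]≤⇒[1+]*≤)
open Outexpansion using (expandsRobustly)

lemma3p5 : (τ ε : ℚ) → 0ℚ < τ → τ < ½ → 0ℚ < ε →
    ∃[ ν₀ ] (0ℚ < ν₀ × ν₀ ≤ τ ×
      ((ν : ℚ) → 0ℚ < ν → ν ≤ ν₀ →
        ∃[ n₀ ] ((n : ℕ) → n₀ ≤ℕ n →
          (G : Digraph (3 * n)) → BalancedTripartite n G →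
          (d : ℕ) → Regular G d → (1ℚ + ε) Data.Rational.* ℕ→ℚ n ≤ ℕ→ℚ d →
          RobustOutexpander ν τ G)))
-- Any n₀ works.
lemma3p5 τ ε 0<τ _ 0<ε =
  let m , 1/M≤τ = positive⇒1/[1+]≤ 0<τ
      l , 1/L≤ε = positive⇒1/[1+]≤ 0<ε
      κ = pred (scale (suc l) (suc m))
  in 1/[1+ κ ] , 1/[1+]-pos κ , ℚ.≤-trans (1/[1+]-antimono (s≤s⁻¹ (M≤scale {suc l} {suc m}))) 1/M≤τ ,
     λ ν _ ν≤ν₀ → 0 , λ n _ G BT d reg [1+ε]n≤d →
       let D , d≡n+D , n≤LD = excess {suc l} (1/[1+]≤⇒[1+]*≤ n d 1/L≤ε [1+ε]n≤d)
       in expandsRobustly {l = l} 1/M≤τ ν≤ν₀ G BT (subst (Regular G) d≡n+D reg) n≤LD
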